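{- Let $\mathcal H=(V,\mathcal E)$ be a hypergraph with $V=\{1,\dots,|V|\}$, let $E_i=\{u_1,\dots,u_h\}\in\mathcal E$ be a hyperedge, and let $S_i$ be the string constructed from $E_i$ as below. Define $R(E_i)=R_1R_2\cdots R_{|V|}$ where $R_j=01$ if $j\in E_i$ and $R_j=0$ otherwise. Then $S_i$ does not contain $R(E_i)$ as a subsequence.
   Context: With $u_1<\dots<u_h$, the string $S_i=T_1T_2\cdots T_{|V|+|E_i|-1}$ over $\{0,1\}$ is defined by $T_j=0$ if $j=u_k+k-1$ for some $1\le k\le h$, and $T_j=01$ otherwise. A string $Y$ is a subsequence of $X$ if obtained from $X$ by deleting characters. -}

module Defs where

open import Data.Bool using (Bool; true; false; if_then_else_)
open import Data.Nat using (ℕ; suc; _+_; _∸_; _≡ᵇ_)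
open import Data.Fin using (Fin; toℕ)
open import Data.List using (List; []; _∷_; map; filter; zipWith; upTo; concatMap; allFin)
open import Data.Bool.ListAction using (any)
open import Data.Fin.Subset using (Subset; ∣_∣)
open import Data.Fin.Subset.Properties using (_∈?_)
open import Relation.Nullary using (does)

-- Vertices are {1,…,n}; Fin n index i stands for vertex suc (toℕ i).
-- Binary alphabet: false = 0, true = 1.

sortedElems : ∀ {n} → Subset n → List ℕ
sortedElems {n} E = map (λ i → suc (toℕ i)) (filter (λ i → i ∈? E) (allFin n))

-- positions u_k + k - 1 (k = 1..h); with 0-based k' = k-1 this is u + k'.
zeroPositions : ∀ {n} → Subset n → List ℕ
zeroPositions {n} E = zipWith (λ k u → u + k) (upTo ∣ E ∣) (sortedElems E)

T : ∀ {n} → Subset n → ℕ → List Bool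
T E j = if any (λ p → j ≡ᵇ p) (zeroPositions E) then false ∷ [] else false ∷ true ∷ []

S : ∀ {n} → Subset n → List Bool
S {n} E = concatMap (T E) (map suc (upTo (n + ∣ E ∣ ∸ 1)))

R : ∀ {n} → Subset n → List Bool
R {n} E = concatMap (λ i → if does (i ∈? E) then false ∷ true ∷ [] else false ∷ []) (allFin n)

record Hypergraph (n : ℕ) : Set where
  field
    edges : List (Subset n)

{-# OPTIONS --safe #-}
-- Cut S_i after the blocks belonging to each vertex j: for j ∈ E_i this is the 0-block
-- T_{u_k+k-1} followed by a 01-block, i.e. 0 01, for j ∉ E_i a single 01, and appending one
-- more 01 to S_i makes the cut exact.  Likewise R(E_i) is cut into R_j = 01 resp. 0.  Embed
-- R(E_i) 0 into S_i 01 block by block: what remains of R(E_i) 0 always starts with 0, so it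
-- can never use the trailing 1 of a 01, and R_j is used up within the blocks of vertex j.
-- Hence the final 0 has nothing left to go to.
module Submission where

open import Defs
open import Data.Nat using (ℕ)
open import Data.Fin.Subset using (Subset; Nonempty)
open import Data.List.Membership.Propositional using (_∈_)
open import Data.List.Relation.Binary.Sublist.Propositional using (_⊆_)
open import Relation.Nullary using (¬_)

open import Data.Bool using (Bool; true; false; if_then_else_; _∨_)
open import Data.Bool.ListAction using (any)
open import Data.Fin as Fin using (Fin; toℕ)
open import Data.Fin.Subset using (∣_∣; inside; outside)
open import Data.Fin.Subset.Properties using (_∈?_)
open import Data.List
  using (List; []; _∷_; _++_; [_]; map; filter; zipWith; upTo; concatMap; tabulate; allFin; head)
open import Data.List.Properties
  using ( map-∘; map-tabulate; map-applyUpTo; applyUpTo-∷ʳ; map-++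
        ; concatMap-map; concatMap-cong; concatMap-++; ++-assoc; ++-identityʳ)
open import Data.List.Relation.Binary.Sublist.Propositional
  using ([]; _∷_; _∷ʳ_)
open import Data.List.Relation.Binary.Sublist.Propositional.Properties
  using (∷⁻; ∷ʳ⁻; ++⁺)
open import Data.Maybe using (just)
open import Data.Nat using (zero; suc; _+_; _≡ᵇ_)
open import Data.Nat.Properties using (+-suc)
open import Data.Product using (_,_)
open import Data.Vec using ([]; _∷_; toList)
open import Function using (id; _∘_; flip)
open import Relation.Nullary using (does)
open import Relation.Binary.PropositionalEquality
  using (_≡_; refl; sym; trans; cong; cong₂; subst₂; module ≡-Reasoning)

open ≡-Reasoning

tBlock rBlock pBlock : Bool → List Bool
tBlock b = if b then false ∷ [] else false ∷ true ∷ []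
rBlock x = if x then false ∷ true ∷ [] else false ∷ []
pBlock x = if x then false ∷ false ∷ true ∷ [] else false ∷ true ∷ []

head-rBlocks : ∀ xs {Z} → head Z ≡ just false → head (concatMap rBlock xs ++ Z) ≡ just false
head-rBlocks []            h = h
head-rBlocks (inside  ∷ _) _ = refl
head-rBlocks (outside ∷ _) _ = refl

⊆-skip-true : ∀ {Z W} → head Z ≡ just false → Z ⊆ true ∷ W → Z ⊆ W
⊆-skip-true {false ∷ _} _ = ∷ʳ⁻ λ ()

rBlock-pBlock-++⁻ : ∀ x {Z W} → head Z ≡ just false →
  rBlock x ++ Z ⊆ pBlock x ++ W → Z ⊆ W
rBlock-pBlock-++⁻ inside  _ = ∷⁻ ∘ ∷ʳ⁻ (λ ()) ∘ ∷⁻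
rBlock-pBlock-++⁻ outside h = ⊆-skip-true h ∘ ∷⁻

rBlocks-pBlocks-++⁻ : ∀ xs {Z W} → head Z ≡ just false →
  concatMap rBlock xs ++ Z ⊆ concatMap pBlock xs ++ W → Z ⊆ W
rBlocks-pBlocks-++⁻ []       h s = s
rBlocks-pBlocks-++⁻ (x ∷ xs) {Z} {W} h s =
  rBlocks-pBlocks-++⁻ xs h (rBlock-pBlock-++⁻ x (head-rBlocks xs h)
    (subst₂ _⊆_ (++-assoc (rBlock x) _ Z) (++-assoc (pBlock x) _ W) s))

tabulate-∈? : ∀ {n} (E : Subset n) → tabulate (λ i → does (i ∈? E)) ≡ toList E
tabulate-∈? []            = refl
tabulate-∈? (inside  ∷ E) = cong (true ∷_) (tabulate-∈? E)
tabulate-∈? (outside ∷ E) = cong (false ∷_) (tabulate-∈? E)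

R≡concatMap-rBlock : ∀ {n} (E : Subset n) → R E ≡ concatMap rBlock (toList E)
R≡concatMap-rBlock {n} E = begin
  R E
    ≡⟨ concatMap-map rBlock (λ i → does (i ∈? E)) (allFin n) ⟨
  concatMap rBlock (map (λ i → does (i ∈? E)) (allFin n))
    ≡⟨ cong (concatMap rBlock) (map-tabulate id (λ i → does (i ∈? E))) ⟩
  concatMap rBlock (tabulate (λ i → does (i ∈? E)))
    ≡⟨ cong (concatMap rBlock) (tabulate-∈? E) ⟩
  concatMap rBlock (toList E)
    ∎

filter-∈?-map-suc : ∀ {n} x (E : Subset n) (is : List (Fin n)) →
  filter (_∈? x ∷ E) (map Fin.suc is) ≡ map Fin.suc (filter (_∈? E) is)
filter-∈?-map-suc x E []       = refl
filter-∈?-map-suc x E (i ∷ is) with does (i ∈? E)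
... | true  = cong (Fin.suc i ∷_) (filter-∈?-map-suc x E is)
... | false = filter-∈?-map-suc x E is

sortedElems-tail : ∀ {n} x (E : Subset n) →
  map (suc ∘ toℕ) (filter (_∈? x ∷ E) (tabulate Fin.suc)) ≡ map suc (sortedElems E)
sortedElems-tail {n} x E = begin
  map (suc ∘ toℕ) (filter (_∈? x ∷ E) (tabulate Fin.suc))
    ≡⟨ cong (map (suc ∘ toℕ) ∘ filter (_∈? x ∷ E)) (map-tabulate id Fin.suc) ⟨
  map (suc ∘ toℕ) (filter (_∈? x ∷ E) (map Fin.suc (allFin n)))
    ≡⟨ cong (map (suc ∘ toℕ)) (filter-∈?-map-suc x E (allFin n)) ⟩
  map (suc ∘ toℕ) (map Fin.suc (filter (_∈? E) (allFin n)))
    ≡⟨ map-∘ {g = suc ∘ toℕ} {f = Fin.suc} (filter (_∈? E) (allFin n)) ⟨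
  map (suc ∘ toℕ ∘ Fin.suc) (filter (_∈? E) (allFin n))
    ≡⟨ map-∘ {g = suc} {f = suc ∘ toℕ} (filter (_∈? E) (allFin n)) ⟩
  map suc (sortedElems E)
    ∎

zipWith-flip-+-mapʳ-suc : ∀ ks us →
  zipWith (flip _+_) ks (map suc us) ≡ map suc (zipWith (flip _+_) ks us)
zipWith-flip-+-mapʳ-suc []       _        = refl
zipWith-flip-+-mapʳ-suc (_ ∷ _)  []       = refl
zipWith-flip-+-mapʳ-suc (k ∷ ks) (u ∷ us) = cong (suc (u + k) ∷_) (zipWith-flip-+-mapʳ-suc ks us)

zipWith-flip-+-map-suc : ∀ ks us →
  zipWith (flip _+_) (map suc ks) (map suc us) ≡ map suc (map suc (zipWith (flip _+_) ks us))
zipWith-flip-+-map-suc []       _        = refl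
zipWith-flip-+-map-suc (_ ∷ _)  []       = refl
zipWith-flip-+-map-suc (k ∷ ks) (u ∷ us) = cong₂ _∷_ (cong suc (+-suc u k)) (zipWith-flip-+-map-suc ks us)

upTo-suc : ∀ m → upTo (suc m) ≡ 0 ∷ map suc (upTo m)
upTo-suc m = cong (0 ∷_) (sym (map-applyUpTo id suc m))

zeroPositions-outside : ∀ {n} (E : Subset n) → zeroPositions (outside ∷ E) ≡ map suc (zeroPositions E)
zeroPositions-outside E = begin
  zipWith (flip _+_) (upTo ∣ E ∣) (sortedElems (outside ∷ E))
    ≡⟨ cong (zipWith (flip _+_) (upTo ∣ E ∣)) (sortedElems-tail outside E) ⟩
  zipWith (flip _+_) (upTo ∣ E ∣) (map suc (sortedElems E))
    ≡⟨ zipWith-flip-+-mapʳ-suc (upTo ∣ E ∣) (sortedElems E) ⟩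
  map suc (zeroPositions E)
    ∎

zeroPositions-inside : ∀ {n} (E : Subset n) →
  zeroPositions (inside ∷ E) ≡ map suc (0 ∷ map suc (zeroPositions E))
zeroPositions-inside E = begin
  zipWith (flip _+_) (upTo (suc ∣ E ∣)) (sortedElems (inside ∷ E))
    ≡⟨ cong₂ (zipWith (flip _+_)) (upTo-suc ∣ E ∣) (cong (1 ∷_) (sortedElems-tail inside E)) ⟩
  1 ∷ zipWith (flip _+_) (map suc (upTo ∣ E ∣)) (map suc (sortedElems E))
    ≡⟨ cong (1 ∷_) (zipWith-flip-+-map-suc (upTo ∣ E ∣) (sortedElems E)) ⟩
  map suc (0 ∷ map suc (zeroPositions E))
    ∎

infix 5 _∈ᵇ_
_∈ᵇ_ : ℕ → List ℕ → Bool
j ∈ᵇ L = any (j ≡ᵇ_) L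

suc-∈ᵇ-map-suc : ∀ j L → suc j ∈ᵇ map suc L ≡ j ∈ᵇ L
suc-∈ᵇ-map-suc j []      = refl
suc-∈ᵇ-map-suc j (u ∷ L) = cong ((j ≡ᵇ u) ∨_) (suc-∈ᵇ-map-suc j L)

0-∈ᵇ-map-suc : ∀ L → 0 ∈ᵇ map suc L ≡ false
0-∈ᵇ-map-suc []      = refl
0-∈ᵇ-map-suc (_ ∷ L) = 0-∈ᵇ-map-suc L

0-∉-zeroPositions : ∀ {n} (E : Subset n) → 0 ∈ᵇ zeroPositions E ≡ false
0-∉-zeroPositions []            = refl
0-∉-zeroPositions (inside  ∷ E) =
  trans (cong (0 ∈ᵇ_) (zeroPositions-inside E)) (0-∈ᵇ-map-suc (0 ∷ map suc (zeroPositions E)))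
0-∉-zeroPositions (outside ∷ E) =
  trans (cong (0 ∈ᵇ_) (zeroPositions-outside E)) (0-∈ᵇ-map-suc (zeroPositions E))

last-∉-zeroPositions : ∀ {n} (E : Subset n) → n + ∣ E ∣ ∈ᵇ zeroPositions E ≡ false
last-∉-zeroPositions []                    = refl
last-∉-zeroPositions {suc n} (inside  ∷ E) = begin
  suc n + suc ∣ E ∣ ∈ᵇ zeroPositions (inside ∷ E)
    ≡⟨ cong₂ _∈ᵇ_ (cong suc (+-suc n ∣ E ∣)) (zeroPositions-inside E) ⟩
  suc (suc (n + ∣ E ∣)) ∈ᵇ map suc (0 ∷ map suc (zeroPositions E))
    ≡⟨ suc-∈ᵇ-map-suc (suc (n + ∣ E ∣)) (0 ∷ map suc (zeroPositions E)) ⟩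
  suc (n + ∣ E ∣) ∈ᵇ map suc (zeroPositions E)
    ≡⟨ suc-∈ᵇ-map-suc (n + ∣ E ∣) (zeroPositions E) ⟩
  n + ∣ E ∣ ∈ᵇ zeroPositions E
    ≡⟨ last-∉-zeroPositions E ⟩
  false
    ∎
last-∉-zeroPositions {suc n} (outside ∷ E) = begin
  suc (n + ∣ E ∣) ∈ᵇ zeroPositions (outside ∷ E) ≡⟨ cong (suc (n + ∣ E ∣) ∈ᵇ_) (zeroPositions-outside E) ⟩
  suc (n + ∣ E ∣) ∈ᵇ map suc (zeroPositions E)   ≡⟨ suc-∈ᵇ-map-suc (n + ∣ E ∣) (zeroPositions E) ⟩
  n + ∣ E ∣ ∈ᵇ zeroPositions E                   ≡⟨ last-∉-zeroPositions E ⟩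
  false                                          ∎

tBlocks : List ℕ → List ℕ → List Bool
tBlocks L js = concatMap (λ j → tBlock (j ∈ᵇ L)) js

tBlocks-map-suc : ∀ L js → tBlocks (map suc L) (map suc js) ≡ tBlocks L js
tBlocks-map-suc L js = trans (concatMap-map _ suc js)
  (concatMap-cong (λ j → cong tBlock (suc-∈ᵇ-map-suc j L)) js)

tBlocks-0∷-map-suc : ∀ L js → tBlocks (0 ∷ L) (map suc js) ≡ tBlocks L (map suc js)
tBlocks-0∷-map-suc L js = trans (concatMap-map _ suc js) (sym (concatMap-map _ suc js))

tBlocks-map-suc-upTo-suc : ∀ L k →
  tBlocks (map suc L) (map suc (upTo (suc k))) ≡ tBlock (0 ∈ᵇ L) ++ tBlocks L (map suc (upTo k))
tBlocks-map-suc-upTo-suc L k = trans (tBlocks-map-suc L (upTo (suc k))) (cong (tBlocks L) (upTo-suc k))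

tBlocks-map-suc-zeroPositions : ∀ {n} (E : Subset n) →
  tBlocks (map suc (zeroPositions E)) (map suc (upTo (suc (n + ∣ E ∣))))
    ≡ tBlock false ++ tBlocks (zeroPositions E) (map suc (upTo (n + ∣ E ∣)))
tBlocks-map-suc-zeroPositions {n} E =
  trans (tBlocks-map-suc-upTo-suc (zeroPositions E) (n + ∣ E ∣))
        (cong (λ b → tBlock b ++ tBlocks (zeroPositions E) (map suc (upTo (n + ∣ E ∣)))) (0-∉-zeroPositions E))

tBlocks-zeroPositions : ∀ {n} (E : Subset n) →
  tBlocks (zeroPositions E) (map suc (upTo (n + ∣ E ∣))) ≡ concatMap pBlock (toList E)
tBlocks-zeroPositions []                    = refl
tBlocks-zeroPositions {suc n} (outside ∷ E) = begin
  tBlocks (zeroPositions (outside ∷ E)) (map suc (upTo (suc (n + ∣ E ∣))))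
    ≡⟨ cong (λ L → tBlocks L (map suc (upTo (suc (n + ∣ E ∣))))) (zeroPositions-outside E) ⟩
  tBlocks (map suc (zeroPositions E)) (map suc (upTo (suc (n + ∣ E ∣))))
    ≡⟨ tBlocks-map-suc-zeroPositions E ⟩
  tBlock false ++ tBlocks (zeroPositions E) (map suc (upTo (n + ∣ E ∣)))
    ≡⟨ cong (pBlock outside ++_) (tBlocks-zeroPositions E) ⟩
  pBlock outside ++ concatMap pBlock (toList E)
    ∎
tBlocks-zeroPositions {suc n} (inside  ∷ E) = begin
  tBlocks (zeroPositions (inside ∷ E)) (map suc (upTo (suc n + suc ∣ E ∣)))
    ≡⟨ cong₂ tBlocks (zeroPositions-inside E) (cong (map suc ∘ upTo ∘ suc) (+-suc n ∣ E ∣)) ⟩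
  tBlocks (map suc (0 ∷ map suc (zeroPositions E))) (map suc (upTo (suc (suc (n + ∣ E ∣)))))
    ≡⟨ tBlocks-map-suc-upTo-suc (0 ∷ map suc (zeroPositions E)) (suc (n + ∣ E ∣)) ⟩
  tBlock true ++ tBlocks (0 ∷ map suc (zeroPositions E)) (map suc (upTo (suc (n + ∣ E ∣))))
    ≡⟨ cong (false ∷_) (tBlocks-0∷-map-suc (map suc (zeroPositions E)) (upTo (suc (n + ∣ E ∣)))) ⟩
  false ∷ tBlocks (map suc (zeroPositions E)) (map suc (upTo (suc (n + ∣ E ∣))))
    ≡⟨ cong (false ∷_) (tBlocks-map-suc-zeroPositions E) ⟩
  false ∷ tBlock false ++ tBlocks (zeroPositions E) (map suc (upTo (n + ∣ E ∣)))
    ≡⟨ cong (pBlock inside ++_) (tBlocks-zeroPositions E) ⟩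
  pBlock inside ++ concatMap pBlock (toList E)
    ∎

S++tBlock-false≡concatMap-pBlock : ∀ {n} (E : Subset (suc n)) →
  S E ++ tBlock false ≡ concatMap pBlock (toList E)
S++tBlock-false≡concatMap-pBlock {n} E = begin
  S E ++ tBlock false                                  ≡⟨ cong (λ b → S E ++ tBlock b) (last-∉-zeroPositions E) ⟨
  S E ++ tBlock (suc k ∈ᵇ L)                           ≡⟨ cong (S E ++_) (++-identityʳ (tBlock (suc k ∈ᵇ L))) ⟨
  tBlocks L (map suc (upTo k)) ++ tBlocks L [ suc k ]  ≡⟨ concatMap-++ _ (map suc (upTo k)) [ suc k ] ⟨
  tBlocks L (map suc (upTo k) ++ [ suc k ])            ≡⟨ cong (tBlocks L) (map-++ suc (upTo k) [ k ]) ⟨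
  tBlocks L (map suc (upTo k ++ [ k ]))                ≡⟨ cong (tBlocks L ∘ map suc) (applyUpTo-∷ʳ id k) ⟩
  tBlocks L (map suc (upTo (suc k)))                   ≡⟨ tBlocks-zeroPositions E ⟩
  concatMap pBlock (toList E)                          ∎
  where
  k : ℕ
  k = n + ∣ E ∣
  L : List ℕ
  L = zeroPositions E

lemma5 : (n : ℕ) (H : Hypergraph n) (E : Subset n) →
    E ∈ Hypergraph.edges H → Nonempty E → ¬ (R E ⊆ S E)
lemma5 zero    _ [] _ (() , _)
lemma5 (suc n) _ E  _ _ R⊆S = [false]⊈[] (rBlocks-pBlocks-++⁻ (toList E) refl R++0⊆P++[])
  where
  [false]⊈[] : ¬ (false ∷ [] ⊆ [])
  [false]⊈[] ()
  R++0⊆P++[] : concatMap rBlock (toList E) ++ false ∷ [] ⊆ concatMap pBlock (toList E) ++ []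
  R++0⊆P++[] = subst₂ _⊆_ (cong (_++ false ∷ []) (R≡concatMap-rBlock E))
    (trans (S++tBlock-false≡concatMap-pBlock E) (sym (++-identityʳ _)))
    (++⁺ R⊆S (refl ∷ (true ∷ʳ [])))
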